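{- Let $\mathcal{T}$ be a class of finite ordered sets such that no $T\in\mathcal{T}$ contains a nontrivial order-autonomous antichain, and such that the Automorphism Conjecture holds for $\mathcal{T}$, i.e. $\lim_{n\to\infty}\sup\{|{\rm Aut}(T)|/|{\rm End}(T)| : T\in\mathcal{T},\ |T|= n\}=0$ (a supremum over the empty set being $0$). Let $\mathcal{A}$ be the class of ordered sets obtained from some $T\in\mathcal{T}$ by replacing every element $t\in T$ by a nonempty (possibly one-element) antichain $A_t$; i.e. $P=\bigcup_{t\in T}A_t$ (disjoint union) ordered by: for $a\in A_s$, $b\in A_t$, $a<b$ iff $s<t$ in $T$. Then the Automorphism Conjecture holds for $\mathcal{A}$, i.e. $\lim_{n\to\infty}\sup\{|{\rm Aut}(P)|/|{\rm End}(P)| : P\in\mathcal{A},\ |P|= n\}=0$.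
   Context: For a finite ordered set $P$, ${\rm Aut}(P)$ is the set of automorphisms and ${\rm End}(P)$ the set of order-preserving self-maps. A nonempty subset $A\subseteq P$ is order-autonomous iff for every $z\in P\setminus A$: if $z<a$ for some $a\in A$ then $z<a$ for all $a\in A$, and if $z>a$ for some $a\in A$ then $z>a$ for all $a\in A$. It is nontrivial iff $|A|\notin\{1,|P|\}$. An antichain is a set of pairwise incomparable elements. -}

module Defs where

open import Data.Nat using (ℕ; zero; suc; _*_; _≤_)
open import Data.Fin using (Fin; zero; suc; _≟_)
open import Data.Fin.Subset using (Subset; _∈_; _∉_; ∣_∣; Nonempty)
open import Data.List using (List; []; _∷_; map; concatMap; filter; length)
open import Data.Bool.ListAction using (all)
open import Data.List.Base using (allFin)
open import Data.Bool using (Bool; true; false; T; _∧_; _∨_; not)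
open import Data.Bool.Properties using (T?) renaming (_≟_ to _≟𝔹_)
open import Data.Product using (Σ; _×_; ∃; ∃-syntax)
open import Relation.Nullary using (¬_)
open import Relation.Nullary.Decidable using (⌊_⌋)
open import Relation.Binary.PropositionalEquality using (_≡_; _≢_)
open import Function.Base using (_∘_)
open import Function.Bundles using (_⇔_)

record FinPoset : Set where
  field
    size      : ℕ
    le        : Fin size → Fin size → Bool
    reflexive : ∀ x → T (le x x)
    antisym   : ∀ x y → T (le x y) → T (le y x) → x ≡ y
    trans     : ∀ x y z → T (le x y) → T (le y z) → T (le x z)

open FinPoset public

Lt : (P : FinPoset) → Fin (size P) → Fin (size P) → Set
Lt P x y = T (le P x y) × x ≢ y

-- Enumeration of all self-maps of Fin n (each function exactly once,
-- up to pointwise equality), used to count |End P| and |Aut P|.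

consF : ∀ {m n} → Fin n → (Fin m → Fin n) → Fin (suc m) → Fin n
consF i f zero    = i
consF i f (suc x) = f x

allFuns : (m n : ℕ) → List (Fin m → Fin n)
allFuns zero    n = (λ ()) ∷ []
allFuns (suc m) n = concatMap (λ f → map (λ i → consF i f) (allFin n)) (allFuns m n)

all₂ : ∀ {n} → (Fin n → Fin n → Bool) → Bool
all₂ {n} p = all (λ x → all (λ y → p x y) (allFin n)) (allFin n)

_≡ᵇ_ : ∀ {n} → Fin n → Fin n → Bool
x ≡ᵇ y = ⌊ x ≟ y ⌋

isEnd : (P : FinPoset) → (Fin (size P) → Fin (size P)) → Bool
isEnd P f = all₂ (λ x y → not (le P x y) ∨ le P (f x) (f y))

-- f is an automorphism: a bijection with  x ≤ y ⇔ f x ≤ f y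
-- (so that f and f⁻¹ are order-preserving).  On a finite set,
-- an injective self-map is bijective.
isAut : (P : FinPoset) → (Fin (size P) → Fin (size P)) → Bool
isAut P f = all₂ (λ x y → (not (f x ≡ᵇ f y) ∨ (x ≡ᵇ y))
                          ∧ ⌊ le P x y ≟𝔹 le P (f x) (f y) ⌋)

#End : FinPoset → ℕ
#End P = length (filter (λ f → T? (isEnd P f)) (allFuns (size P) (size P)))

#Aut : FinPoset → ℕ
#Aut P = length (filter (λ f → T? (isAut P f)) (allFuns (size P) (size P)))

Class : Set₁
Class = FinPoset → Set

-- Automorphism Conjecture for a class 𝒞:
--   lim_{n→∞} sup { |Aut P| / |End P| : P ∈ 𝒞, |P| = n } = 0
-- (sup ∅ = 0), i.e. for every k there is N such that for all n ≥ N and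
-- all P ∈ 𝒞 with |P| = n, |Aut P| / |End P| ≤ 1/(k+1).
AutomorphismConjecture : Class → Set
AutomorphismConjecture 𝒞 =
  (k : ℕ) → ∃[ N ] ((P : FinPoset) → 𝒞 P → N ≤ size P →
                      suc k * #Aut P ≤ #End P)

OrderAutonomous : (P : FinPoset) → Subset (size P) → Set
OrderAutonomous P A =
  Nonempty A ×
  (∀ z → z ∉ A →
     (∀ a b → a ∈ A → b ∈ A → Lt P z a → Lt P z b) ×
     (∀ a b → a ∈ A → b ∈ A → Lt P a z → Lt P b z))

Nontrivial : (P : FinPoset) → Subset (size P) → Set
Nontrivial P A = ∣ A ∣ ≢ 1 × ∣ A ∣ ≢ size P

Antichain : (P : FinPoset) → Subset (size P) → Set
Antichain P A = ∀ a b → a ∈ A → b ∈ A → a ≢ b → ¬ T (le P a b)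

HasNontrivialAutonomousAntichain : FinPoset → Set
HasNontrivialAutonomousAntichain P =
  ∃[ A ] (OrderAutonomous P A × Nontrivial P A × Antichain P A)

-- P is obtained from T by replacing each t ∈ T by a nonempty antichain A_t:
-- the blocks A_t = π⁻¹(t) of a surjection π : P → T partition P, and
-- for a ∈ A_s, b ∈ A_t:  a < b  iff  s < t.

IsAntichainReplacement : (T′ P : FinPoset) → Set
IsAntichainReplacement T′ P =
  Σ (Fin (size P) → Fin (size T′)) λ π →
    (∀ t → ∃[ a ] π a ≡ t) ×
    (∀ a b → Lt P a b ⇔ Lt T′ (π a) (π b))

Replacements : Class → Class
Replacements 𝒯 P = ∃[ T′ ] (𝒯 T′ × IsAntichainReplacement T′ P)

{-# OPTIONS --safe #-}
module Submission where

-- Let π : P → T′ be the block map, fix a representative in each block and let j be the number of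
-- non-representatives, so |P| ≤ |T′| + j.  Composing each automorphism of P with the identity or
-- with one of the j maps collapsing a non-representative onto its representative gives (j+1)|Aut P|
-- distinct endomorphisms, which settles the case j ≥ k.  If j < k, then T′ is large, hence twin-free
-- (two twins form a nontrivial autonomous antichain), so the blocks are exactly the twin classes of P.
-- Every automorphism of P therefore induces one of T′, and is determined by it together with where
-- it sends the j non-representatives: |Aut P| ≤ (k+1)^k |Aut T′|.  Endomorphisms of T′ lift along
-- the representatives, so |End T′| ≤ |End P|, and the conjecture for 𝒯 at (k+1)^(k+1) concludes.

open import Defs
open import Relation.Nullary using (¬_)

open import Level using (0ℓ)
open import Function.Base using (id; _∘_)
open import Function.Bundles using (_⇔_; mk⇔; Equivalence)
open import Function.Definitions using (Injective)
open import Function.Properties.Equivalence using () renaming (refl to ⇔-refl; sym to ⇔-sym; trans to ⇔-trans)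
open import Function.Related.TypeIsomorphisms using (→-cong-⇔)
open import Relation.Binary.Bundles using (Setoid; DecSetoid)
open import Relation.Binary.PropositionalEquality
  using (_≡_; _≢_; refl; sym; cong; cong₂; subst; subst₂; _≗_; module ≡-Reasoning)
import Relation.Binary.PropositionalEquality as ≡
open import Relation.Nullary using (Dec; ¬?; yes; no; contradiction)
open import Relation.Nullary.Decidable using (⌊_⌋; toWitness; fromWitness; does-⇔)

open import Data.Unit using (tt)
open import Data.Bool using (Bool; true; false; T; not; _∨_; _∧_)
open import Data.Bool.ListAction using (and; all)
open import Data.Bool.Properties using (T?; T-∧) renaming (_≟_ to _≟𝔹_)
open import Data.Product using (_×_; _,_; proj₁; proj₂; ∃)
open import Data.Product.Function.NonDependent.Propositional using (_×-⇔_)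
open import Data.Product.Relation.Binary.Pointwise.NonDependent using (_×ₛ_; ×-decSetoid)
open import Data.Sum using (_⊎_; inj₁; inj₂; [_,_]; [_,_]′)
open import Data.Maybe using (Maybe; nothing; just)
open import Data.Maybe.Properties as Maybe using (just-injective)
import Data.Maybe.Relation.Unary.All as Maybe

open import Data.Nat using (ℕ; zero; suc; _+_; _*_; _^_; _≤_; _<_; z≤n; s≤s; _≤?_)
open import Data.Nat.Properties
  using ( ≤-refl; ≤-trans; <⇒≤; ≰⇒>; n≤1+n; m≤m+n; m≤n+m; +-monoʳ-≤; +-cancelʳ-≤
        ; *-monoˡ-≤; *-monoʳ-≤; *-comm; *-assoc; ^-monoˡ-≤; ^-monoʳ-≤; module ≤-Reasoning)
open import Data.Fin using (Fin; zero; suc; _≟_; punchOut)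
import Data.Fin.Properties as Fin
open import Data.Fin.Subset using (Subset; ∣_∣; Nonempty; ⁅_⁆; _∪_) renaming (_∈_ to _∈ₛ_; _∉_ to _∉ₛ_)
open import Data.Fin.Subset.Properties
  using (x∈⁅x⁆; x∈⁅y⁆⇒x≡y; x∈p∪q⁺; x∈p∪q⁻; p⊆p∪q; p⊂q⇒∣p∣<∣q∣; ∣⁅x⁆∣≡1; ∣p∣≡n⇒p≡⊤; ∈⊤)
import Data.Vec.Functional.Relation.Binary.Pointwise.Properties as Pointwise

open import Data.List
  using (List; []; _∷_; map; filter; length; allFin; concatMap; cartesianProductWith; cartesianProduct; _++_)
open import Data.List.Properties as List
  using (filter-all; length-++; length-map; length-tabulate; map-cong; ∷-injective)
open import Data.List.Relation.Unary.All as All using (All; []; _∷_)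
open import Data.List.Relation.Unary.All.Properties as All using (all-filter)
open import Data.List.Relation.Unary.Any using (here; there)
open import Data.List.Relation.Unary.AllPairs as AllPairs using (AllPairs; []; _∷_)
import Data.List.Relation.Unary.AllPairs.Properties as AllPairs
import Data.List.Relation.Unary.Unique.Setoid as UniqueS
import Data.List.Relation.Unary.Unique.Setoid.Properties as Unique
open import Data.List.Relation.Unary.Unique.Propositional.Properties using (allFin⁺)
open import Data.List.Membership.Propositional using () renaming (_∈_ to _∈ᴸ_)
open import Data.List.Membership.Propositional.Properties
  using (∈-allFin; ∈-cartesianProductWith⁺; ∈-filter⁺; ∈-map⁺; ∈-++⁺ˡ; ∈-++⁺ʳ)
import Data.List.Membership.Setoid as MembershipS
import Data.List.Membership.Setoid.Properties as Membership

module _ (S : DecSetoid 0ℓ 0ℓ) where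
  open DecSetoid S using (Carrier; _≈_; setoid) renaming (_≟_ to _≈?_; sym to ≈-sym; trans to ≈-trans)
  open import Data.List.Membership.Setoid setoid using (_∈_)

  length-≤-of-injection : ∀ {X : Set} (Φ : X → Carrier) {xs : List X} {ys : List Carrier} →
                          AllPairs (λ x x′ → ¬ Φ x ≈ Φ x′) xs → All (λ x → Φ x ∈ ys) xs →
                          length xs ≤ length ys
  length-≤-of-injection Φ {[]}    _ _           = z≤n
  length-≤-of-injection Φ {_ ∷ _} {[]} _ (() ∷ _)
  length-≤-of-injection {X} Φ {xs} {y ∷ ys} distinct images =
    ≤-trans (removes-at-most-one xs distinct)
            (s≤s (length-≤-of-injection Φ (AllPairs.filter⁺ missesY? distinct) imagesInYs))
    where
    missesY? : (x : X) → Dec (¬ Φ x ≈ y)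
    missesY? x = ¬? (Φ x ≈? y)

    removes-at-most-one : ∀ xs → AllPairs (λ x x′ → ¬ Φ x ≈ Φ x′) xs →
                          length xs ≤ suc (length (filter missesY? xs))
    removes-at-most-one []       _           = z≤n
    removes-at-most-one (x ∷ xs) (x≉ ∷ rest) with Φ x ≈? y
    ... | yes x≈y rewrite filter-all missesY? (All.map (λ x≉x′ x′≈y → x≉x′ (≈-trans x≈y (≈-sym x′≈y))) x≉)
      = ≤-refl
    ... | no  _   = s≤s (removes-at-most-one xs rest)

    imagesInYs : All (λ x → Φ x ∈ ys) (filter missesY? xs)
    imagesInYs = All.map inYs (All.zip (All.filter⁺ missesY? images , all-filter missesY? xs))
      where
      inYs : ∀ {x} → Φ x ∈ (y ∷ ys) × ¬ Φ x ≈ y → Φ x ∈ ys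
      inYs (here  x≈y , x≉y) = contradiction x≈y x≉y
      inYs (there x∈ys , _)  = x∈ys

AllPairs-mapWith : ∀ {A : Set} {P : A → Set} {R S : A → A → Set} →
                   (∀ {x y} → P x → P y → R x y → S x y) →
                   ∀ {xs} → All P xs → AllPairs R xs → AllPairs S xs
AllPairs-mapWith f []         []         = []
AllPairs-mapWith f (px ∷ pxs) (rx ∷ rxs) =
  All.zipWith (λ (py , r) → f px py r) (pxs , rx) ∷ AllPairs-mapWith f pxs rxs

length-cartesianProductWith : ∀ {A B C : Set} (f : A → B → C) xs ys →
                              length (cartesianProductWith f xs ys) ≡ length xs * length ys
length-cartesianProductWith f []       ys = refl
length-cartesianProductWith f (x ∷ xs) ys = begin
  length (map (f x) ys ++ cartesianProductWith f xs ys)  ≡⟨ length-++ (map (f x) ys) ⟩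
  length (map (f x) ys) + length (cartesianProductWith f xs ys)
    ≡⟨ cong₂ _+_ (length-map (f x) ys) (length-cartesianProductWith f xs ys) ⟩
  length ys + length xs * length ys                      ∎
  where open ≡-Reasoning

concatMap-map≡cartesianProductWith : ∀ {A B C : Set} (f : A → B → C) xs ys →
  concatMap (λ x → map (f x) ys) xs ≡ cartesianProductWith f xs ys
concatMap-map≡cartesianProductWith f []       ys = refl
concatMap-map≡cartesianProductWith f (x ∷ xs) ys =
  cong (map (f x) ys ++_) (concatMap-map≡cartesianProductWith f xs ys)

words : ∀ {A : Set} → List A → ℕ → List (List A)
words as zero    = [] ∷ []
words as (suc k) = cartesianProductWith _∷_ as (words as k)

length-words : ∀ {A : Set} (as : List A) k → length (words as k) ≡ length as ^ k
length-words as zero    = refl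
length-words as (suc k) = ≡.trans (length-cartesianProductWith _∷_ as (words as k))
                                (cong (length as *_) (length-words as k))

∈-words : ∀ {A : Set} {as : List A} {w} → All (_∈ᴸ as) w → w ∈ᴸ words as (length w)
∈-words []         = here refl
∈-words (a∈ ∷ w∈) = ∈-cartesianProductWith⁺ _∷_ a∈ (∈-words w∈)

map-≡⇒All : ∀ {A B : Set} {f g : A → B} xs → map f xs ≡ map g xs → All (λ x → f x ≡ g x) xs
map-≡⇒All []       _  = []
map-≡⇒All (x ∷ xs) eq = proj₁ (∷-injective eq) ∷ map-≡⇒All xs (proj₂ (∷-injective eq))

≗-decSetoid : ℕ → ℕ → DecSetoid 0ℓ 0ℓ
≗-decSetoid m n = Pointwise.decSetoid (Fin.≡-decSetoid n) m

≗-setoid : ℕ → ℕ → Setoid 0ℓ 0ℓ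
≗-setoid m n = DecSetoid.setoid (≗-decSetoid m n)

allFuns-suc : ∀ m n → allFuns (suc m) n ≡ cartesianProductWith (λ f i → consF i f) (allFuns m n) (allFin n)
allFuns-suc m n = concatMap-map≡cartesianProductWith (λ f i → consF i f) (allFuns m n) (allFin n)

allFuns-unique : ∀ m n → UniqueS.Unique (≗-setoid m n) (allFuns m n)
allFuns-unique zero    n = [] ∷ []
allFuns-unique (suc m) n = subst (UniqueS.Unique (≗-setoid (suc m) n)) (sym (allFuns-suc m n))
  (Unique.cartesianProductWith⁺ (≗-setoid m n) (≡.setoid (Fin n)) (≗-setoid (suc m) n) _
    (λ e → (λ x → e (suc x)) , e zero) (allFuns-unique m n) (allFin⁺ n))

allFuns-complete : ∀ m n (f : Fin m → Fin n) → MembershipS._∈_ (≗-setoid m n) f (allFuns m n)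
allFuns-complete zero    n f = here (λ ())
allFuns-complete (suc m) n f = subst (MembershipS._∈_ (≗-setoid (suc m) n) f) (sym (allFuns-suc m n))
  (Membership.∈-resp-≈ (≗-setoid (suc m) n) f≗head∷tail
    (Membership.∈-cartesianProductWith⁺ (≗-setoid m n) (≡.setoid (Fin n)) (≗-setoid (suc m) n)
      consF-cong (allFuns-complete m n (λ x → f (suc x))) (∈-allFin (f zero))))
  where
  f≗head∷tail : ∀ x → consF (f zero) (λ x → f (suc x)) x ≡ f x
  f≗head∷tail zero    = refl
  f≗head∷tail (suc x) = refl
  consF-cong : ∀ {g g′ i i′} → g ≗ g′ → i ≡ i′ → consF i g ≗ consF i′ g′
  consF-cong _    i≡i′ zero    = i≡i′
  consF-cong g≗g′ _    (suc x) = g≗g′ x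

satisfying : ∀ {m n} → ((Fin m → Fin n) → Bool) → List (Fin m → Fin n)
satisfying {m} {n} p = filter (λ f → T? (p f)) (allFuns m n)

module _ {m n : ℕ} (p : (Fin m → Fin n) → Bool) where
  open MembershipS (≗-setoid m n) using (_∈_)

  satisfying-unique : UniqueS.Unique (≗-setoid m n) (satisfying p)
  satisfying-unique = Unique.filter⁺ (≗-setoid m n) (λ f → T? (p f)) (allFuns-unique m n)

  satisfying-sound : All (λ f → T (p f)) (satisfying p)
  satisfying-sound = all-filter (λ f → T? (p f)) (allFuns m n)

  satisfying-complete : (∀ {f g} → f ≗ g → p f ≡ p g) → ∀ {f} → T (p f) → f ∈ satisfying p
  satisfying-complete p-cong {f} pf =
    Membership.∈-filter⁺ (≗-setoid m n) (λ f → T? (p f)) (λ f≗g → subst T (p-cong f≗g))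
      (allFuns-complete m n f) pf

all₂-cong : ∀ {n} {p q : Fin n → Fin n → Bool} → (∀ x y → p x y ≡ q x y) → all₂ p ≡ all₂ q
all₂-cong {n} p≡q = cong and (map-cong (λ x → cong and (map-cong (p≡q x) (allFin n))) (allFin n))

T-all₂ : ∀ {n} {p : Fin n → Fin n → Bool} → T (all₂ p) ⇔ (∀ x y → T (p x y))
T-all₂ {n} {p} = mk⇔
  (λ h x y → All.lookup (All.all⁺ (p x) (allFin n) (All.lookup (All.all⁺ _ (allFin n) h) (∈-allFin x)))
                        (∈-allFin y))
  (λ h → All.all⁻ (λ x → all (p x) (allFin n)) {allFin n}
           (All.tabulate (λ {x} _ → All.all⁻ (p x) {allFin n} (All.tabulate (λ {y} _ → h x y)))))

T-⌊⌋ : ∀ {A : Set} (a? : Dec A) → T ⌊ a? ⌋ ⇔ A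
T-⌊⌋ a? = mk⇔ toWitness fromWitness

T-⇒ : ∀ {a b} → T (not a ∨ b) ⇔ (T a → T b)
T-⇒ {false} = mk⇔ (λ _ ()) (λ _ → tt)
T-⇒ {true}  = mk⇔ (λ b _ → b) (λ f → f tt)


module _ (P : FinPoset) where

  OrderPreserving : (Fin (size P) → Fin (size P)) → Set
  OrderPreserving f = ∀ {x y} → T (le P x y) → T (le P (f x) (f y))

  IsAutomorphism : (Fin (size P) → Fin (size P)) → Set
  IsAutomorphism f = Injective _≡_ _≡_ f × (∀ x y → le P x y ≡ le P (f x) (f y))

  isEnd-cong : ∀ {f g} → f ≗ g → isEnd P f ≡ isEnd P g
  isEnd-cong f≗g = all₂-cong (λ x y → cong₂ (λ u v → not (le P x y) ∨ le P u v) (f≗g x) (f≗g y))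

  isAut-cong : ∀ {f g} → f ≗ g → isAut P f ≡ isAut P g
  isAut-cong f≗g = all₂-cong (λ x y →
    cong₂ (λ u v → (not (u ≡ᵇ v) ∨ (x ≡ᵇ y)) ∧ ⌊ le P x y ≟𝔹 le P u v ⌋) (f≗g x) (f≗g y))

  T-isEnd : ∀ {f} → T (isEnd P f) ⇔ OrderPreserving f
  T-isEnd = mk⇔ (λ h {x} {y} → Equivalence.to (T-⇒ {le P x y}) (Equivalence.to T-all₂ h x y))
                (λ f-mono → Equivalence.from T-all₂ (λ x y → Equivalence.from (T-⇒ {le P x y}) f-mono))

  isAut-at : (f : Fin (size P) → Fin (size P)) (x y : Fin (size P)) →
    T ((not (f x ≡ᵇ f y) ∨ (x ≡ᵇ y)) ∧ ⌊ le P x y ≟𝔹 le P (f x) (f y) ⌋) ⇔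
    ((f x ≡ f y → x ≡ y) × le P x y ≡ le P (f x) (f y))
  isAut-at f x y = ⇔-trans (T-∧ {not (f x ≡ᵇ f y) ∨ (x ≡ᵇ y)})
    (⇔-trans (T-⇒ {f x ≡ᵇ f y}) (→-cong-⇔ (T-⌊⌋ (f x ≟ f y)) (T-⌊⌋ (x ≟ y)))
     ×-⇔ T-⌊⌋ (le P x y ≟𝔹 le P (f x) (f y)))

  T-isAut : ∀ {f} → T (isAut P f) ⇔ IsAutomorphism f
  T-isAut {f} = mk⇔
    (λ h → (λ {x} {y} → proj₁ (at h x y)) , (λ x y → proj₂ (at h x y)))
    (λ (f-inj , f-≤) → Equivalence.from T-all₂ (λ x y → Equivalence.from (isAut-at f x y) (f-inj , f-≤ x y)))
    where
    at : T (isAut P f) → ∀ x y → (f x ≡ f y → x ≡ y) × le P x y ≡ le P (f x) (f y)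
    at h x y = Equivalence.to (isAut-at f x y) (Equivalence.to T-all₂ h x y)

injective⇒surjective : ∀ {n} {f : Fin n → Fin n} → Injective _≡_ _≡_ f → ∀ y → ∃ λ x → f x ≡ y
injective⇒surjective {suc n} {f} f-inj y with Fin.any? (λ x → f x ≟ y)
... | yes hit = hit
... | no  miss = contradiction (λ {x} {x′} → g-injective {x} {x′}) (Fin.<⇒notInjective ≤-refl)
  where
  y≢f : ∀ x → y ≢ f x
  y≢f x y≡fx = miss (x , sym y≡fx)
  g : Fin (suc n) → Fin n
  g x = punchOut (y≢f x)
  g-injective : Injective _≡_ _≡_ g
  g-injective {x} {x′} gx≡gx′ = f-inj (Fin.punchOut-injective (y≢f x) (y≢f x′) gx≡gx′)

injective-agree-off-point : ∀ {n} {f g : Fin n → Fin n} {b} → Injective _≡_ _≡_ f → Injective _≡_ _≡_ g →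
                            (∀ z → z ≢ b → f z ≡ g z) → f ≗ g
injective-agree-off-point {f = f} {g} {b} f-inj g-inj agree z with z ≟ b
... | no  z≢b  = agree z z≢b
... | yes refl with injective⇒surjective f-inj (g z)
...   | w , fw≡gz with w ≟ z
...     | yes refl = fw≡gz
...     | no  w≢z  = contradiction (g-inj (≡.trans (sym (agree w w≢z)) fw≡gz)) w≢z

module _ (Q : FinPoset) where

  ≤⇒≡⊎< : ∀ {x y} → T (le Q x y) → x ≡ y ⊎ Lt Q x y
  ≤⇒≡⊎< {x} {y} x≤y with x ≟ y
  ... | yes x≡y = inj₁ x≡y
  ... | no  x≢y = inj₂ (x≤y , x≢y)

  ≡⇒≤ : ∀ {x y} → x ≡ y → T (le Q x y)
  ≡⇒≤ {x} refl = reflexive Q x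

  <-irrefl : ∀ {x} → ¬ Lt Q x x
  <-irrefl (_ , x≢x) = x≢x refl

  Aut⇒OrderPreserving : ∀ {f} → IsAutomorphism Q f → OrderPreserving Q f
  Aut⇒OrderPreserving (_ , f-≤) {x} {y} = subst T (f-≤ x y)

  Aut⇒<⇔ : ∀ {f} → IsAutomorphism Q f → ∀ {x y} → Lt Q x y ⇔ Lt Q (f x) (f y)
  Aut⇒<⇔ {f} (f-inj , f-≤) {x} {y} = mk⇔
    (λ (x≤y , x≢y) → subst T (f-≤ x y) x≤y , λ fx≡fy → x≢y (f-inj fx≡fy))
    (λ (fx≤fy , fx≢fy) → subst T (sym (f-≤ x y)) fx≤fy , λ x≡y → fx≢fy (cong f x≡y))

  <⇔⇒Aut : ∀ {f} → Injective _≡_ _≡_ f → (∀ {x y} → Lt Q x y ⇔ Lt Q (f x) (f y)) → IsAutomorphism Q f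
  <⇔⇒Aut {f} f-inj f-< = f-inj , λ x y → does-⇔ (mk⇔ (preserve x y) (reflect x y)) (T? _) (T? _)
    where
    preserve : ∀ x y → T (le Q x y) → T (le Q (f x) (f y))
    preserve x y x≤y =
      [ (λ x≡y → ≡⇒≤ (cong f x≡y)) , (λ x<y → proj₁ (Equivalence.to f-< x<y)) ] (≤⇒≡⊎< x≤y)
    reflect : ∀ x y → T (le Q (f x) (f y)) → T (le Q x y)
    reflect x y fx≤fy =
      [ (λ fx≡fy → ≡⇒≤ (f-inj fx≡fy)) , (λ fx<fy → proj₁ (Equivalence.from f-< fx<fy)) ] (≤⇒≡⊎< fx≤fy)

  Twins : Fin (size Q) → Fin (size Q) → Set
  Twins x y = ∀ z → (Lt Q z x ⇔ Lt Q z y) × (Lt Q x z ⇔ Lt Q y z)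

  TwinFree : Set
  TwinFree = ∀ {x y} → Twins x y → x ≡ y

  Twins-refl : ∀ {x} → Twins x x
  Twins-refl z = ⇔-refl , ⇔-refl

  Twins-sym : ∀ {x y} → Twins x y → Twins y x
  Twins-sym xy z = ⇔-sym (proj₁ (xy z)) , ⇔-sym (proj₂ (xy z))

  Aut-reflects-Twins : ∀ {f} → IsAutomorphism Q f → ∀ {x y} → Twins (f x) (f y) → Twins x y
  Aut-reflects-Twins f-aut fxy z =
    ⇔-trans (Aut⇒<⇔ f-aut) (⇔-trans (proj₁ (fxy _)) (⇔-sym (Aut⇒<⇔ f-aut))) ,
    ⇔-trans (Aut⇒<⇔ f-aut) (⇔-trans (proj₂ (fxy _)) (⇔-sym (Aut⇒<⇔ f-aut)))

  Aut-preserves-Twins : ∀ {f} → IsAutomorphism Q f → ∀ {x y} → Twins x y → Twins (f x) (f y)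
  Aut-preserves-Twins f-aut xy w with injective⇒surjective (proj₁ f-aut) w
  ... | z , refl =
    ⇔-trans (⇔-sym (Aut⇒<⇔ f-aut)) (⇔-trans (proj₁ (xy z)) (Aut⇒<⇔ f-aut)) ,
    ⇔-trans (⇔-sym (Aut⇒<⇔ f-aut)) (⇔-trans (proj₂ (xy z)) (Aut⇒<⇔ f-aut))

distinct-from-both : ∀ {n} → 3 ≤ n → (x y : Fin n) → ∃ λ z → z ≢ x × z ≢ y
distinct-from-both (s≤s (s≤s (s≤s _))) zero          zero          = suc zero , (λ ()) , (λ ())
distinct-from-both (s≤s (s≤s (s≤s _))) zero          (suc zero)    = suc (suc zero) , (λ ()) , (λ ())
distinct-from-both (s≤s (s≤s (s≤s _))) zero          (suc (suc _)) = suc zero , (λ ()) , (λ ())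
distinct-from-both (s≤s (s≤s (s≤s _))) (suc zero)    zero          = suc (suc zero) , (λ ()) , (λ ())
distinct-from-both (s≤s (s≤s (s≤s _))) (suc zero)    (suc _)       = zero , (λ ()) , (λ ())
distinct-from-both (s≤s (s≤s (s≤s _))) (suc (suc _)) zero          = suc zero , (λ ()) , (λ ())
distinct-from-both (s≤s (s≤s (s≤s _))) (suc (suc _)) (suc _)       = zero , (λ ()) , (λ ())

no-autonomous-antichain⇒TwinFree : ∀ Q → 3 ≤ size Q → ¬ HasNontrivialAutonomousAntichain Q → TwinFree Q
no-autonomous-antichain⇒TwinFree Q size≥3 none {x} {y} x~y with x ≟ y
... | yes x≡y = x≡y
... | no  x≢y = contradiction (pair , (nonempty , autonomous) , (≢1 , ≢size) , antichain) none
  where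
  pair : Subset (size Q)
  pair = ⁅ x ⁆ ∪ ⁅ y ⁆

  x∈pair : x ∈ₛ pair
  x∈pair = x∈p∪q⁺ (inj₁ (x∈⁅x⁆ x))

  y∈pair : y ∈ₛ pair
  y∈pair = x∈p∪q⁺ (inj₂ (x∈⁅x⁆ y))

  ∈pair⇒≡ : ∀ {a} → a ∈ₛ pair → a ≡ x ⊎ a ≡ y
  ∈pair⇒≡ a∈pair with x∈p∪q⁻ ⁅ x ⁆ ⁅ y ⁆ a∈pair
  ... | inj₁ a∈x = inj₁ (x∈⁅y⁆⇒x≡y x a∈x)
  ... | inj₂ a∈y = inj₂ (x∈⁅y⁆⇒x≡y y a∈y)

  pair-Twins : ∀ {a b} → a ∈ₛ pair → b ∈ₛ pair → Twins Q a b
  pair-Twins a∈ b∈ with ∈pair⇒≡ a∈ | ∈pair⇒≡ b∈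
  ... | inj₁ refl | inj₁ refl = Twins-refl Q
  ... | inj₁ refl | inj₂ refl = x~y
  ... | inj₂ refl | inj₁ refl = Twins-sym Q x~y
  ... | inj₂ refl | inj₂ refl = Twins-refl Q

  nonempty : Nonempty pair
  nonempty = x , x∈pair

  autonomous : ∀ z → z ∉ₛ pair →
    (∀ a b → a ∈ₛ pair → b ∈ₛ pair → Lt Q z a → Lt Q z b) ×
    (∀ a b → a ∈ₛ pair → b ∈ₛ pair → Lt Q a z → Lt Q b z)
  autonomous z _ = (λ a b a∈ b∈ → Equivalence.to (proj₁ (pair-Twins a∈ b∈ z)))
                 , (λ a b a∈ b∈ → Equivalence.to (proj₂ (pair-Twins a∈ b∈ z)))

  antichain : Antichain Q pair
  antichain a b a∈ b∈ a≢b a≤b = <-irrefl Q (Equivalence.to (proj₂ (pair-Twins a∈ b∈ b)) (a≤b , a≢b))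

  ≢1 : ∣ pair ∣ ≢ 1
  ≢1 ∣pair∣≡1 = <-irrefl′ (subst₂ _<_ (∣⁅x⁆∣≡1 x) ∣pair∣≡1 (p⊂q⇒∣p∣<∣q∣ (p⊆p∪q ⁅ y ⁆ , y , y∈pair , y∉x)))
    where
    y∉x : y ∉ₛ ⁅ x ⁆
    y∉x y∈x = x≢y (sym (x∈⁅y⁆⇒x≡y x y∈x))
    <-irrefl′ : ¬ 1 < 1
    <-irrefl′ (s≤s ())

  ≢size : ∣ pair ∣ ≢ size Q
  ≢size ∣pair∣≡size with distinct-from-both size≥3 x y
  ... | z , z≢x , z≢y = [ z≢x , z≢y ]′ (∈pair⇒≡ (subst (z ∈ₛ_) (sym (∣p∣≡n⇒p≡⊤ ∣pair∣≡size)) ∈⊤))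

module Replacement {T′ P : FinPoset} (replacement : IsAntichainReplacement T′ P) where

  π : Fin (size P) → Fin (size T′)
  π = proj₁ replacement

  rep : Fin (size T′) → Fin (size P)
  rep t = proj₁ (proj₁ (proj₂ replacement) t)

  π∘rep : ∀ t → π (rep t) ≡ t
  π∘rep t = proj₂ (proj₁ (proj₂ replacement) t)

  <⇔π< : ∀ {a b} → Lt P a b ⇔ Lt T′ (π a) (π b)
  <⇔π< {a} {b} = proj₂ (proj₂ replacement) a b

  rep<⇔ : ∀ {s b} → Lt P (rep s) b ⇔ Lt T′ s (π b)
  rep<⇔ {s} {b} = subst (λ u → Lt P (rep s) b ⇔ Lt T′ u (π b)) (π∘rep s) <⇔π<

  <rep⇔ : ∀ {a t} → Lt P a (rep t) ⇔ Lt T′ (π a) t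
  <rep⇔ {a} {t} = subst (λ u → Lt P a (rep t) ⇔ Lt T′ (π a) u) (π∘rep t) <⇔π<

  rep<rep⇔ : ∀ {s t} → Lt P (rep s) (rep t) ⇔ Lt T′ s t
  rep<rep⇔ {s} {t} = subst (λ u → Lt P (rep s) (rep t) ⇔ Lt T′ s u) (π∘rep t) rep<⇔

  π-invariant⇒OrderPreserving : ∀ {g} → (∀ x → π (g x) ≡ π x) → OrderPreserving P g
  π-invariant⇒OrderPreserving {g} πg≡π {x} {y} x≤y with ≤⇒≡⊎< P x≤y
  ... | inj₁ refl = reflexive P (g x)
  ... | inj₂ x<y  = proj₁ (Equivalence.from <⇔π< (subst₂ (Lt T′) (sym (πg≡π x)) (sym (πg≡π y))
                                                          (Equivalence.to <⇔π< x<y)))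

  NonRep : Fin (size P) → Set
  NonRep x = x ≢ rep (π x)

  nonReps : List (Fin (size P))
  nonReps = filter (λ x → ¬? (x ≟ rep (π x))) (allFin (size P))

  ∈-nonReps : ∀ {x} → NonRep x → x ∈ᴸ nonReps
  ∈-nonReps {x} = ∈-filter⁺ (λ x → ¬? (x ≟ rep (π x))) (∈-allFin x)

  size≤ : size P ≤ size T′ + length nonReps
  size≤ = begin
    size P                                     ≡⟨ length-tabulate id ⟨
    length (allFin (size P))                   ≤⟨ length-≤-of-injection (Fin.≡-decSetoid (size P)) id
                                                    (allFin⁺ (size P)) (All.tabulate (λ {x} _ → repOrNonRep x)) ⟩
    length (map rep (allFin (size T′)) ++ nonReps)
      ≡⟨ length-++ (map rep (allFin (size T′))) ⟩
    length (map rep (allFin (size T′))) + length nonReps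
      ≡⟨ cong (_+ length nonReps) (≡.trans (length-map rep (allFin (size T′))) (length-tabulate id)) ⟩
    size T′ + length nonReps                   ∎
    where
    open ≤-Reasoning
    repOrNonRep : ∀ x → x ∈ᴸ map rep (allFin (size T′)) ++ nonReps
    repOrNonRep x with x ≟ rep (π x)
    ... | yes x≡rep = ∈-++⁺ˡ {ys = nonReps} (subst (_∈ᴸ _) (sym x≡rep) (∈-map⁺ rep (∈-allFin (π x))))
    ... | no  x≢rep = ∈-++⁺ʳ _ (∈-nonReps x≢rep)

  lift : (Fin (size T′) → Fin (size T′)) → Fin (size P) → Fin (size P)
  lift f x = rep (f (π x))

  lift-OrderPreserving : ∀ {f} → OrderPreserving T′ f → OrderPreserving P (lift f)
  lift-OrderPreserving {f} f-mono {x} {y} x≤y with ≤⇒≡⊎< P x≤y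
  ... | inj₁ refl = reflexive P (lift f x)
  ... | inj₂ x<y with ≤⇒≡⊎< T′ (f-mono (proj₁ (Equivalence.to <⇔π< x<y)))
  ...   | inj₁ fx≡fy = ≡⇒≤ P (cong rep fx≡fy)
  ...   | inj₂ fx<fy = proj₁ (Equivalence.from rep<rep⇔ fx<fy)

  lift-injective : ∀ {f g} → lift f ≗ lift g → f ≗ g
  lift-injective {f} {g} lf≗lg t = begin
    f t                 ≡⟨ cong f (π∘rep t) ⟨
    f (π (rep t))       ≡⟨ π∘rep _ ⟨
    π (lift f (rep t))  ≡⟨ cong π (lf≗lg (rep t)) ⟩
    π (lift g (rep t))  ≡⟨ π∘rep _ ⟩
    g (π (rep t))       ≡⟨ cong g (π∘rep t) ⟩
    g t                 ∎
    where open ≡-Reasoning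

  #End[T′]≤#End[P] : #End T′ ≤ #End P
  #End[T′]≤#End[P] = length-≤-of-injection (≗-decSetoid (size P) (size P)) lift
    (AllPairs.map (λ f≉g lf≈lg → f≉g (lift-injective lf≈lg)) (satisfying-unique (isEnd T′)))
    (All.map (λ f-end → satisfying-complete (isEnd P) (isEnd-cong P)
                          (Equivalence.from (T-isEnd P) (lift-OrderPreserving (Equivalence.to (T-isEnd T′) f-end))))
             (satisfying-sound (isEnd T′)))

  maybeNonReps : List (Maybe (Fin (size P)))
  maybeNonReps = nothing ∷ map just nonReps

  maybeNonReps-unique : UniqueS.Unique (≡.setoid (Maybe (Fin (size P)))) maybeNonReps
  maybeNonReps-unique =
    All.map⁺ (All.tabulate (λ _ ()))
    ∷ AllPairs.map⁺ (AllPairs.map (λ x≢y jx≡jy → x≢y (just-injective jx≡jy))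
                                  (AllPairs.filter⁺ _ (allFin⁺ (size P))))

  maybeNonReps-NonRep : All (Maybe.All NonRep) maybeNonReps
  maybeNonReps-NonRep =
    Maybe.nothing ∷ All.map⁺ (All.map Maybe.just (all-filter (λ x → ¬? (x ≟ rep (π x))) (allFin (size P))))

  collapse : Maybe (Fin (size P)) → Fin (size P) → Fin (size P)
  collapse nothing  z = z
  collapse (just b) z with z ≟ b
  ... | yes _ = rep (π b)
  ... | no  _ = z

  π∘collapse : ∀ i z → π (collapse i z) ≡ π z
  π∘collapse nothing  z = refl
  π∘collapse (just b) z with z ≟ b
  ... | yes refl = π∘rep (π z)
  ... | no  _    = refl

  collapse-self : ∀ b → collapse (just b) b ≡ rep (π b)
  collapse-self b with b ≟ b
  ... | yes _   = refl
  ... | no  b≢b = contradiction refl b≢b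

  collapse-fix : ∀ i z → i ≢ just z → collapse i z ≡ z
  collapse-fix nothing  z _  = refl
  collapse-fix (just b) z i≢z with z ≟ b
  ... | yes refl = contradiction refl i≢z
  ... | no  _    = refl

  collapse-separates : ∀ {i b} → Maybe.All NonRep i → NonRep b → i ≢ just b →
                       collapse i b ≢ collapse i (rep (π b))
  collapse-separates {i} {b} i-ok b-nonRep i≢b merged = b-nonRep (begin
    b                          ≡⟨ collapse-fix i b i≢b ⟨
    collapse i b               ≡⟨ merged ⟩
    collapse i (rep (π b))     ≡⟨ collapse-fix i (rep (π b)) i≢rep ⟩
    rep (π b)                  ∎)
    where
    open ≡-Reasoning
    i≢rep : i ≢ just (rep (π b))
    i≢rep i≡rep = Maybe.drop-just (subst (Maybe.All NonRep) i≡rep i-ok) (cong rep (sym (π∘rep (π b))))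

  collapsed : Maybe (Fin (size P)) × (Fin (size P) → Fin (size P)) → Fin (size P) → Fin (size P)
  collapsed (i , h) z = h (collapse i z)

  collapsed-index : ∀ {b i′ h h′} → NonRep b → Maybe.All NonRep i′ → Injective _≡_ _≡_ h′ →
                    collapsed (just b , h) ≗ collapsed (i′ , h′) → i′ ≡ just b
  collapsed-index {b} {i′} {h} {h′} b-nonRep i′-ok h′-inj same with Maybe.≡-dec _≟_ i′ (just b)
  ... | yes i′≡b = i′≡b
  ... | no  i′≢b = contradiction (h′-inj (begin
    h′ (collapse i′ b)                ≡⟨ same b ⟨
    h (collapse (just b) b)           ≡⟨ cong h (collapse-self b) ⟩
    h (rep (π b))                     ≡⟨ cong h (collapse-fix (just b) (rep (π b)) (b-nonRep ∘ just-injective)) ⟨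
    h (collapse (just b) (rep (π b))) ≡⟨ same (rep (π b)) ⟩
    h′ (collapse i′ (rep (π b)))      ∎))
    (collapse-separates i′-ok b-nonRep i′≢b)
    where open ≡-Reasoning

  Admissible : Maybe (Fin (size P)) × (Fin (size P) → Fin (size P)) → Set
  Admissible (i , h) = Maybe.All NonRep i × IsAutomorphism P h

  -- collapse (just b) identifies exactly b with its representative, and h, h′ are injective.
  collapsed-injective : ∀ {x y} → Admissible x → Admissible y → collapsed x ≗ collapsed y →
                        proj₁ x ≡ proj₁ y × proj₂ x ≗ proj₂ y
  collapsed-injective {nothing , _} {nothing , _} _ _ same = refl , same
  collapsed-injective {nothing , h} {just b′ , h′} (_ , h-aut) (Maybe.just b′-nonRep , _) same
    with () ← collapsed-index {h = h′} b′-nonRep Maybe.nothing (proj₁ h-aut) (λ z → sym (same z))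
  collapsed-injective {just b , h} {i′ , h′} (Maybe.just b-nonRep , h-aut) (i′-ok , h′-aut) same
    with refl ← collapsed-index {h = h} b-nonRep i′-ok (proj₁ h′-aut) same
    = refl , injective-agree-off-point (proj₁ h-aut) (proj₁ h′-aut) agree
    where
    agree : ∀ z → z ≢ b → h z ≡ h′ z
    agree z z≢b = subst₂ (λ u v → h u ≡ h′ v) fixed fixed (same z)
      where
      fixed : collapse (just b) z ≡ z
      fixed = collapse-fix (just b) z (λ b≡z → z≢b (sym (just-injective b≡z)))

  collapses*#Aut≤#End : suc (length nonReps) * #Aut P ≤ #End P
  collapses*#Aut≤#End = begin
    suc (length nonReps) * #Aut P     ≡⟨ cong (_* #Aut P) (cong suc (length-map just nonReps)) ⟨
    length maybeNonReps * #Aut P      ≡⟨ length-cartesianProductWith _,_ maybeNonReps (satisfying (isAut P)) ⟨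
    length family                     ≤⟨ length-≤-of-injection (≗-decSetoid (size P) (size P)) collapsed
                                           (AllPairs-mapWith (λ ok ok′ ≉ ≈ → ≉ (collapsed-injective ok ok′ ≈))
                                              admissible family-unique)
                                           (All.map collapsed-End admissible) ⟩
    #End P                            ∎
    where
    open ≤-Reasoning
    family : List (Maybe (Fin (size P)) × (Fin (size P) → Fin (size P)))
    family = cartesianProduct maybeNonReps (satisfying (isAut P))

    admissible : All Admissible family
    admissible = All.cartesianProduct⁺ (≡.setoid _) (≡.setoid _) maybeNonReps (satisfying (isAut P))
      (λ i∈ h∈ → All.lookup maybeNonReps-NonRep i∈
               , Equivalence.to (T-isAut P) (All.lookup (satisfying-sound (isAut P)) h∈))

    family-unique : UniqueS.Unique (≡.setoid (Maybe (Fin (size P))) ×ₛ ≗-setoid (size P) (size P)) family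
    family-unique = Unique.cartesianProduct⁺ (≡.setoid _) (≗-setoid (size P) (size P))
                      maybeNonReps-unique (satisfying-unique (isAut P))

    collapsed-End : ∀ {x} → Admissible x → MembershipS._∈_ (≗-setoid (size P) (size P)) (collapsed x) (satisfying (isEnd P))
    collapsed-End {i , h} (_ , h-aut) = satisfying-complete (isEnd P) (isEnd-cong P)
      (Equivalence.from (T-isEnd P) (Aut⇒OrderPreserving P h-aut ∘ π-invariant⇒OrderPreserving (π∘collapse i)))

  same-block⇒Twins : ∀ {x y} → π x ≡ π y → Twins P x y
  same-block⇒Twins {x} {y} πx≡πy z =
    ⇔-trans <⇔π< (subst (λ t → Lt T′ (π z) t ⇔ Lt P z y) (sym πx≡πy) (⇔-sym <⇔π<)) ,
    ⇔-trans <⇔π< (subst (λ t → Lt T′ t (π z) ⇔ Lt P y z) (sym πx≡πy) (⇔-sym <⇔π<))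

  Twins⇒π-Twins : ∀ {x y} → Twins P x y → Twins T′ (π x) (π y)
  Twins⇒π-Twins x~y u =
    ⇔-trans (⇔-sym rep<⇔) (⇔-trans (proj₁ (x~y (rep u))) rep<⇔) ,
    ⇔-trans (⇔-sym <rep⇔) (⇔-trans (proj₂ (x~y (rep u))) <rep⇔)

  induced : (Fin (size P) → Fin (size P)) → Fin (size T′) → Fin (size T′)
  induced h t = π (h (rep t))

  code : Fin (size P) → Maybe (Fin (size P))
  code v with v ≟ rep (π v)
  ... | yes _ = nothing
  ... | no  _ = just v

  code∈maybeNonReps : ∀ v → code v ∈ᴸ maybeNonReps
  code∈maybeNonReps v with v ≟ rep (π v)
  ... | yes _        = here refl
  ... | no  v-nonRep = there (∈-map⁺ just (∈-nonReps v-nonRep))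

  code-injective : ∀ {u v} → π u ≡ π v → code u ≡ code v → u ≡ v
  code-injective {u} {v} πu≡πv codes with u ≟ rep (π u) | v ≟ rep (π v)
  ... | yes u≡rep | yes v≡rep = ≡.trans u≡rep (≡.trans (cong rep πu≡πv) (sym v≡rep))
  ... | no  _     | no  _     = just-injective codes
  ... | yes _     | no  _     with () ← codes
  ... | no  _     | yes _     with () ← codes

  word : (Fin (size P) → Fin (size P)) → List (Maybe (Fin (size P)))
  word h = map (λ x → code (h x)) nonReps

  word∈words : ∀ h → word h ∈ᴸ words maybeNonReps (length nonReps)
  word∈words h = subst (λ k → word h ∈ᴸ words maybeNonReps k) (length-map _ nonReps)
                   (∈-words (All.map⁺ (All.tabulate (λ {x} _ → code∈maybeNonReps (h x)))))

  module _ (twinFree : TwinFree T′) where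

    Twins⇒same-block : ∀ {x y} → Twins P x y → π x ≡ π y
    Twins⇒same-block = twinFree ∘ Twins⇒π-Twins

    module _ {h} (h-aut : IsAutomorphism P h) where

      preserves-blocks : ∀ {x y} → π x ≡ π y → π (h x) ≡ π (h y)
      preserves-blocks = Twins⇒same-block ∘ Aut-preserves-Twins P h-aut ∘ same-block⇒Twins

      reflects-blocks : ∀ {x y} → π (h x) ≡ π (h y) → π x ≡ π y
      reflects-blocks = Twins⇒same-block ∘ Aut-reflects-Twins P h-aut ∘ same-block⇒Twins

      π∘h : ∀ x → π (h x) ≡ induced h (π x)
      π∘h x = preserves-blocks (sym (π∘rep (π x)))

      induced-Aut : IsAutomorphism T′ (induced h)
      induced-Aut = <⇔⇒Aut T′ induced-injective (⇔-trans (⇔-sym rep<rep⇔) (⇔-trans (Aut⇒<⇔ P h-aut) <⇔π<))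
        where
        induced-injective : Injective _≡_ _≡_ (induced h)
        induced-injective {s} {t} same =
          ≡.trans (sym (π∘rep s)) (≡.trans (reflects-blocks same) (π∘rep t))

    Aut-determined : ∀ {h h′} → IsAutomorphism P h → IsAutomorphism P h′ → induced h ≗ induced h′ →
                     (∀ x → NonRep x → h x ≡ h′ x) → h ≗ h′
    Aut-determined {h} {h′} h-aut h′-aut same-induced agree x with x ≟ rep (π x)
    ... | no  x-nonRep = agree x x-nonRep
    ... | yes x≡rep with injective⇒surjective (proj₁ h-aut) (h′ x)
    ...   | w , hw≡h′x = subst (λ u → h u ≡ h′ x) w≡x hw≡h′x
      where
      πw≡πx : π w ≡ π x
      πw≡πx = reflects-blocks h-aut (begin
        π (h w)              ≡⟨ cong π hw≡h′x ⟩
        π (h′ x)             ≡⟨ π∘h h′-aut x ⟩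
        induced h′ (π x)     ≡⟨ same-induced (π x) ⟨
        induced h (π x)      ≡⟨ π∘h h-aut x ⟨
        π (h x)              ∎)
        where open ≡-Reasoning
      w≡x : w ≡ x
      w≡x with w ≟ rep (π w)
      ... | yes w≡rep    = ≡.trans w≡rep (≡.trans (cong rep πw≡πx) (sym x≡rep))
      ... | no  w-nonRep = proj₁ h′-aut (≡.trans (sym (agree w w-nonRep)) hw≡h′x)

    -- The word of h records h x for non-representatives x only up to the block of h x,
    -- which the induced automorphism already determines.
    #Aut[P]≤ : ∀ {k} → length nonReps ≤ k → #Aut P ≤ suc k ^ k * #Aut T′
    #Aut[P]≤ {k} j≤k = begin
      #Aut P
        ≤⟨ length-≤-of-injection S signature
             (AllPairs-mapWith signature-separates automorphisms (satisfying-unique (isAut P)))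
             (All.map signature∈ automorphisms) ⟩
      length (cartesianProduct (satisfying (isAut T′)) (words maybeNonReps j))
        ≡⟨ length-cartesianProductWith _,_ (satisfying (isAut T′)) _ ⟩
      #Aut T′ * length (words maybeNonReps j)
        ≡⟨ cong (#Aut T′ *_) (length-words maybeNonReps j) ⟩
      #Aut T′ * length maybeNonReps ^ j
        ≡⟨ cong (λ l → #Aut T′ * suc l ^ j) (length-map just nonReps) ⟩
      #Aut T′ * suc j ^ j
        ≤⟨ *-monoʳ-≤ (#Aut T′) (≤-trans (^-monoˡ-≤ j (s≤s j≤k)) (^-monoʳ-≤ (suc k) j≤k)) ⟩
      #Aut T′ * suc k ^ k
        ≡⟨ *-comm (#Aut T′) (suc k ^ k) ⟩
      suc k ^ k * #Aut T′
        ∎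
      where
      open ≤-Reasoning
      j : ℕ
      j = length nonReps

      S : DecSetoid 0ℓ 0ℓ
      S = ×-decSetoid (≗-decSetoid (size T′) (size T′)) (≡.decSetoid (List.≡-dec (Maybe.≡-dec _≟_)))

      signature : (Fin (size P) → Fin (size P)) → (Fin (size T′) → Fin (size T′)) × List (Maybe (Fin (size P)))
      signature h = induced h , word h

      automorphisms : All (IsAutomorphism P) (satisfying (isAut P))
      automorphisms = All.map (Equivalence.to (T-isAut P)) (satisfying-sound (isAut P))

      signature-separates : ∀ {h h′} → IsAutomorphism P h → IsAutomorphism P h′ → ¬ h ≗ h′ →
                            ¬ (induced h ≗ induced h′ × word h ≡ word h′)
      signature-separates {h} {h′} h-aut h′-aut h≉h′ (same-induced , same-word) =
        h≉h′ (Aut-determined h-aut h′-aut same-induced λ x x-nonRep →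
          code-injective (≡.trans (π∘h h-aut x) (≡.trans (same-induced (π x)) (sym (π∘h h′-aut x))))
                         (All.lookup (map-≡⇒All nonReps same-word) (∈-nonReps x-nonRep)))

      signature∈ : ∀ {h} → IsAutomorphism P h → MembershipS._∈_ (DecSetoid.setoid S) (signature h)
                           (cartesianProduct (satisfying (isAut T′)) (words maybeNonReps j))
      signature∈ {h} h-aut = Membership.∈-cartesianProduct⁺ (≗-setoid (size T′) (size T′)) (≡.setoid _)
        (satisfying-complete (isAut T′) (isAut-cong T′) (Equivalence.from (T-isAut T′) (induced-Aut h-aut)))
        (word∈words h)

proposition2p1 : (𝒯 : Class) →
    ((T′ : FinPoset) → 𝒯 T′ → ¬ HasNontrivialAutonomousAntichain T′) →
    AutomorphismConjecture 𝒯 →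
    AutomorphismConjecture (Replacements 𝒯)
proposition2p1 𝒯 no-antichain conjecture k = 3 + N + k , bound
  where
  K : ℕ
  K = suc k ^ suc k

  N : ℕ
  N = proj₁ (conjecture K)

  -- Either k points of P are not representatives, or T′ has at least 3 + N points; the 3 makes
  -- a pair of twins a nontrivial subset.
  bound : (P : FinPoset) → Replacements 𝒯 P → 3 + N + k ≤ size P → suc k * #Aut P ≤ #End P
  bound P (T′ , T′∈𝒯 , replacement) large = by-cases (k ≤? length nonReps)
    where
    open Replacement {T′} {P} replacement
    open ≤-Reasoning
    by-cases : Dec (k ≤ length nonReps) → suc k * #Aut P ≤ #End P
    by-cases (yes k≤j) = ≤-trans (*-monoˡ-≤ (#Aut P) (s≤s k≤j)) collapses*#Aut≤#End
    by-cases (no  k≰j) = begin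
      suc k * #Aut P                ≤⟨ *-monoʳ-≤ (suc k) (#Aut[P]≤ twinFree j≤k) ⟩
      suc k * (suc k ^ k * #Aut T′) ≡⟨ *-assoc (suc k) (suc k ^ k) (#Aut T′) ⟨
      K * #Aut T′                   ≤⟨ *-monoˡ-≤ (#Aut T′) (n≤1+n K) ⟩
      suc K * #Aut T′               ≤⟨ proj₂ (conjecture K) T′ T′∈𝒯 (≤-trans (m≤n+m N 3) T′-large) ⟩
      #End T′                       ≤⟨ #End[T′]≤#End[P] ⟩
      #End P                        ∎
      where
      j≤k : length nonReps ≤ k
      j≤k = <⇒≤ (≰⇒> k≰j)
      T′-large : 3 + N ≤ size T′
      T′-large = +-cancelʳ-≤ k (3 + N) (size T′) (≤-trans large (≤-trans size≤ (+-monoʳ-≤ (size T′) j≤k)))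
      twinFree : TwinFree T′
      twinFree = no-autonomous-antichain⇒TwinFree T′ (≤-trans (m≤m+n 3 N) T′-large) (no-antichain T′ T′∈𝒯)
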